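{- For every integer $k\ge 1$, the cycle $C_{4k}$ admits a $4$-graceful $\alpha$-labeling.
   Context: $C_n$ denotes the cycle on $n$ vertices (with $n$ edges). For a graph $\Gamma$ of size $e$ and a divisor $d$ of $e$ with $e=d\cdot m$, a $d$-graceful labeling of $\Gamma$ is an injective function $f:V(\Gamma)\to\{0,1,\ldots,d(m+1)-1\}$ such that $\{|f(x)-f(y)| : [x,y]\in E(\Gamma)\}=\{1,2,\ldots,d(m+1)-1\}\setminus\{m+1,2(m+1),\ldots,(d-1)(m+1)\}$. If $\Gamma$ is bipartite with parts $X,Y$, a $d$-graceful $\alpha$-labeling is a $d$-graceful labeling $f$ such that $\max f(X)<\min f(Y)$ for a suitable ordering of the two parts. -}

module Defs where

open import Data.Nat using (ℕ; zero; suc; _+_; _*_; _≤_; _<_; ∣_-_∣; NonZero)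
open import Data.Nat.DivMod using (_mod_)
open import Data.Fin using (Fin; toℕ)
open import Data.List using (List; map; length; allFin)
open import Data.List.Membership.Propositional using (_∈_)
open import Data.Product using (Σ; ∃; ∃-syntax; _×_; _,_; proj₁; proj₂)
open import Data.Bool using (Bool; true; false)
open import Function.Definitions using (Injective)
open import Function.Bundles using (_⇔_)
open import Relation.Binary.PropositionalEquality using (_≡_; _≢_)
open import Relation.Nullary using (¬_)

-- A finite graph: vertex set Fin nV, edge list of unordered pairs [x,y]
-- (stored as ordered pairs; |f(x) - f(y)| is symmetric).
record Graph : Set where
  field
    nV    : ℕ
    edges : List (Fin nV × Fin nV)
open Graph public

size : Graph → ℕ
size G = length (edges G)

cycleNext : (n : ℕ) → .{{NonZero n}} → Fin n → Fin n
cycleNext n i = (toℕ i + 1) mod n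

Cycle : (n : ℕ) → .{{NonZero n}} → Graph
Cycle n = record { nV = n ; edges = map (λ i → (i , cycleNext n i)) (allFin n) }

edgeLabels : (G : Graph) → (Fin (nV G) → ℕ) → List ℕ
edgeLabels G f = map (λ xy → ∣ f (proj₁ xy) - f (proj₂ xy) ∣) (edges G)

InTarget : ℕ → ℕ → ℕ → Set
InTarget d m t =
  (1 ≤ t × t < d * (m + 1)) ×
  ¬ (∃[ i ] (1 ≤ i × i + 1 ≤ d × t ≡ i * (m + 1)))

record IsDGraceful (G : Graph) (d m : ℕ) (f : Fin (nV G) → ℕ) : Set where
  field
    sizeEq    : size G ≡ d * m
    injective : Injective _≡_ _≡_ f
    bounded   : ∀ x → f x < d * (m + 1)
    labels    : ∀ t → (t ∈ edgeLabels G f) ⇔ InTarget d m t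

IsBipartition : (G : Graph) → (Fin (nV G) → Bool) → Set
IsBipartition G part = ∀ {x y} → (x , y) ∈ edges G → part x ≢ part y

-- d-graceful α-labeling: d-graceful, and max f(X) < min f(Y) for a
-- suitable bipartition (X,Y) of G (choice of the bipartition includes the ordering)
record IsDGracefulα (G : Graph) (d m : ℕ) (f : Fin (nV G) → ℕ) : Set where
  field
    graceful  : IsDGraceful G d m f
    part      : Fin (nV G) → Bool
    bipartite : IsBipartition G part
    separated : ∀ x y → part x ≡ false → part y ≡ true → f x < f y

HasDGracefulα : Graph → ℕ → Set
HasDGracefulα G d = ∃[ m ] ∃[ f ] IsDGracefulα G d m f

module Submission where

-- 1. The target set is the union of the four open blocks (q(m+1), (q+1)(m+1)).
-- 2. Cycle facts: the edge labels of C_n are those of the path 0 … n-1 plus the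
--    closing edge, and for even n the parity classes form a bipartition.
-- 3. The staircase: the path labels pathLabel k j = top - (j + cut k j), where the
--    cut skips the three multiples and the value 2(m+1)+1, split into four segments
--    that fill the blocks; together with 2(m+1)+1 they are exactly the target set.
-- 4. The labelling: vertex 2i gets the low label i + 2[m ≤ i] + [p ≤ i], vertex 2i+1
--    the high label top - (i + [r ≤ i]). When the shifts p, r are admissible (their
--    jumps match those of the cut) the edge labels are the path labels followed by
--    2(m+1)+1 on the closing edge, and all the required properties follow.
-- 5. Admissible shifts exist for m odd and for m even, which proves the theorem.

open import Defs
open import Data.Nat
open import Data.Nat.Properties
open import Data.Nat.DivMod using (_/_; _%_; _mod_; m≡m%n+[m/n]*n; m%n<n; m<n*o⇒m/o<n; m<n⇒m%n≡m; n%n≡0)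
open import Data.Nat.Tactic.RingSolver using (solve-∀)
open import Data.Bool using (Bool; true; false; not; if_then_else_)
open import Data.Bool.Properties using (not-¬; not-injective)
open import Data.Fin using (Fin; toℕ; fromℕ<)
open import Data.Fin.Properties using (toℕ-fromℕ<; toℕ<n; toℕ-injective)
open import Data.List using (allFin)
open import Data.List.Properties using (length-map; length-tabulate)
open import Data.List.Membership.Propositional using (_∈_)
open import Data.List.Membership.Propositional.Properties using (∈-map⁺; ∈-map⁻; ∈-allFin)
open import Data.Product using (∃-syntax; _×_; _,_; proj₂)
open import Data.Sum using (_⊎_; inj₁; inj₂)
open import Function using (id; _∘_)
open import Function.Bundles using (_⇔_; mk⇔; Equivalence)
open import Relation.Nullary using (yes; no; contradiction)
open import Relation.Binary.PropositionalEquality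
open import Relation.Binary.Definitions using (tri<; tri≈; tri>)

≤-by : ∀ {a b} δ → a + δ ≡ b → a ≤ b
≤-by {a} δ refl = m≤m+n a δ

between-multiples : ∀ {q n t} → q * n < t → t < suc q * n → ∀ i → t ≢ i * n
between-multiples {q} {n} lo hi i refl =
  <⇒≱ (*-cancelʳ-< n q i lo) (s≤s⁻¹ (*-cancelʳ-< n i (suc q) hi))

InBlock : ℕ → ℕ → ℕ → ℕ → Set
InBlock m q s t = 1 ≤ s × s ≤ m × t ≡ q * (m + 1) + s

block⇒target : ∀ {d m q s t} → q < d → InBlock m q s t → InTarget d m t
block⇒target {d} {m} {q} {s} q<d (1≤s , s≤m , refl) =
  (≤-trans 1≤s (m≤n+m s (q * (m + 1))) , <-≤-trans t<next (*-monoˡ-≤ (m + 1) q<d)) ,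
  λ { (i , _ , _ , t≡i[m+1]) → between-multiples {q} t>prev t<next i t≡i[m+1] }
  where
  t>prev : q * (m + 1) < q * (m + 1) + s
  t>prev = subst (_≤ q * (m + 1) + s) (+-comm (q * (m + 1)) 1) (+-monoʳ-≤ (q * (m + 1)) 1≤s)
  t<next : q * (m + 1) + s < suc q * (m + 1)
  t<next = subst (q * (m + 1) + s <_) (+-comm (q * (m + 1)) (m + 1))
             (+-monoʳ-< (q * (m + 1)) (subst (s <_) (+-comm 1 m) (s≤s s≤m)))

target⇒block : ∀ {d m t} → InTarget d m t → ∃[ q ] ∃[ s ] (q < d × InBlock m q s t)
target⇒block {d} {m} {t} ((1≤t , t<top) , not-multiple) =
  divide (t % (m + 1)) (t / (m + 1)) (m%n<n t (m + 1)) (m≡m%n+[m/n]*n t (m + 1))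
  where
  instance
    m+1-nonZero : NonZero (m + 1)
    m+1-nonZero = >-nonZero (m≤n+m 1 m)
  -- t = r + q(m+1) with r < m+1; r = 0 would make t a forbidden multiple
  divide : ∀ r q → r < m + 1 → t ≡ r + q * (m + 1) → ∃[ q ] ∃[ s ] (q < d × InBlock m q s t)
  divide zero zero _ t≡0 = contradiction (≤-trans 1≤t (≤-reflexive t≡0)) λ ()
  divide zero (suc q) _ t≡q[m+1] =
    contradiction (suc q , s≤s z≤n , subst (_≤ d) (+-comm 1 (suc q)) q<d , t≡q[m+1]) not-multiple
    where
    q<d : suc q < d
    q<d = *-cancelʳ-< (m + 1) (suc q) d (subst (_< d * (m + 1)) t≡q[m+1] t<top)
  divide (suc s) q s<m+1 t≡ =
    q , suc s , *-cancelʳ-< (m + 1) q d (≤-<-trans (m≤n+m (q * (m + 1)) (suc s)) (subst (_< d * (m + 1)) t≡ t<top)) ,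
    s≤s z≤n , s≤s⁻¹ (subst (suc (suc s) ≤_) (+-comm m 1) s<m+1) , trans t≡ (+-comm (suc s) _)

isOdd : ℕ → Bool
isOdd zero = false
isOdd (suc n) = not (isOdd n)

isOdd-double : ∀ i → isOdd (i + i) ≡ false
isOdd-double zero = refl
isOdd-double (suc i) rewrite +-suc i i | isOdd-double i = refl

data ParityView : ℕ → Set where
  even : ∀ i → ParityView (i + i)
  odd  : ∀ i → ParityView (suc (i + i))

parityView : ∀ v → ParityView v
parityView zero = even 0
parityView (suc v) with parityView v
... | even i = odd i
... | odd i rewrite sym (+-suc i i) = even (suc i)

module _ {n : ℕ} .{{_ : NonZero n}} where

  cycleNext-inner : ∀ (i : Fin n) → suc (toℕ i) < n → toℕ (cycleNext n i) ≡ suc (toℕ i)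
  cycleNext-inner i i+1<n = begin
    toℕ ((toℕ i + 1) mod n) ≡⟨ toℕ-fromℕ< _ ⟩
    (toℕ i + 1) % n         ≡⟨ m<n⇒m%n≡m (subst (_< n) (+-comm 1 (toℕ i)) i+1<n) ⟩
    toℕ i + 1               ≡⟨ +-comm (toℕ i) 1 ⟩
    suc (toℕ i)             ∎
    where open ≡-Reasoning

  cycleNext-last : ∀ (i : Fin n) → suc (toℕ i) ≡ n → toℕ (cycleNext n i) ≡ 0
  cycleNext-last i i+1≡n = begin
    toℕ ((toℕ i + 1) mod n) ≡⟨ toℕ-fromℕ< _ ⟩
    (toℕ i + 1) % n         ≡⟨ cong (_% n) (trans (+-comm (toℕ i) 1) i+1≡n) ⟩
    n % n                   ≡⟨ n%n≡0 n ⟩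
    0                       ∎
    where open ≡-Reasoning

  size-Cycle : size (Cycle n) ≡ n
  size-Cycle = trans (length-map _ (allFin n)) (length-tabulate id)

  PathOrClosingLabel : (ℕ → ℕ) → ℕ → Set
  PathOrClosingLabel F t = (∃[ j ] (suc j < n × t ≡ ∣ F j - F (suc j) ∣)) ⊎ (∃[ j ] (suc j ≡ n × t ≡ ∣ F j - F 0 ∣))

  edge-from∈ : (F : ℕ → ℕ) {j : ℕ} (j<n : j < n) →
               ∣ F j - F (toℕ (cycleNext n (fromℕ< j<n))) ∣ ∈ edgeLabels (Cycle n) (F ∘ toℕ)
  edge-from∈ F j<n = subst (λ u → ∣ F u - F (toℕ (cycleNext n (fromℕ< j<n))) ∣ ∈ _) (toℕ-fromℕ< j<n)
    (∈-map⁺ _ (∈-map⁺ (λ i → (i , cycleNext n i)) (∈-allFin (fromℕ< j<n))))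

  cycle-labels : (F : ℕ → ℕ) {t : ℕ} → t ∈ edgeLabels (Cycle n) (F ∘ toℕ) ⇔ PathOrClosingLabel F t
  cycle-labels F = mk⇔ to from
    where
    to : ∀ {t} → t ∈ edgeLabels (Cycle n) (F ∘ toℕ) → PathOrClosingLabel F t
    to t∈ with ∈-map⁻ _ t∈
    ... | _ , xy∈ , refl with ∈-map⁻ (λ i → (i , cycleNext n i)) xy∈
    ...   | i , _ , refl with suc (toℕ i) <? n
    ...     | yes inner = inj₁ (toℕ i , inner , cong (λ v → ∣ F (toℕ i) - F v ∣) (cycleNext-inner i inner))
    ...     | no outer  = inj₂ (toℕ i , last , cong (λ v → ∣ F (toℕ i) - F v ∣) (cycleNext-last i last))
      where
      last : suc (toℕ i) ≡ n
      last = ≤-antisym (toℕ<n i) (≮⇒≥ outer)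
    from : ∀ {t} → PathOrClosingLabel F t → t ∈ edgeLabels (Cycle n) (F ∘ toℕ)
    from (inj₁ (j , inner , refl)) = subst (λ v → ∣ F j - F v ∣ ∈ _) next≡ (edge-from∈ F j<n)
      where
      j<n = <-trans (n<1+n j) inner
      next≡ : toℕ (cycleNext n (fromℕ< j<n)) ≡ suc j
      next≡ = trans (cycleNext-inner _ (subst (λ u → suc u < n) (sym (toℕ-fromℕ< j<n)) inner))
                    (cong suc (toℕ-fromℕ< j<n))
    from (inj₂ (j , last , refl)) = subst (λ v → ∣ F j - F v ∣ ∈ _) next≡ (edge-from∈ F j<n)
      where
      j<n = subst (j <_) last (n<1+n j)
      next≡ : toℕ (cycleNext n (fromℕ< j<n)) ≡ 0
      next≡ = cycleNext-last _ (trans (cong suc (toℕ-fromℕ< j<n)) last)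

  parity-bipartition : isOdd n ≡ false → IsBipartition (Cycle n) (isOdd ∘ toℕ)
  parity-bipartition n-even xy∈ with ∈-map⁻ (λ j → (j , cycleNext n j)) xy∈
  ... | i , _ , refl with suc (toℕ i) <? n
  ...   | yes inner rewrite cycleNext-inner i inner = not-¬ refl
  ...   | no outer = closing-edge (≤-antisym (toℕ<n i) (≮⇒≥ outer))
    where
    -- the closing edge joins the odd vertex n-1 to the even vertex 0
    closing-edge : suc (toℕ i) ≡ n → isOdd (toℕ i) ≢ isOdd (toℕ (cycleNext n i))
    closing-edge last rewrite cycleNext-last i last =
      λ i-even → contradiction (trans (sym i-odd) i-even) λ ()
      where
      i-odd : isOdd (toℕ i) ≡ true
      i-odd = not-injective (trans (cong isOdd last) n-even)

step : ℕ → ℕ → ℕ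
step zero    i       = 1
step (suc a) zero    = 0
step (suc a) (suc i) = step a i

step-on : ∀ {a i} → a ≤ i → step a i ≡ 1
step-on {zero}  _         = refl
step-on {suc a} (s≤s a≤i) = step-on a≤i

step-off : ∀ {a i} → i < a → step a i ≡ 0
step-off {suc a} {zero}  _         = refl
step-off {suc a} {suc i} (s≤s i<a) = step-off i<a

step-≤1 : ∀ a i → step a i ≤ 1
step-≤1 zero    i       = ≤-refl
step-≤1 (suc a) zero    = z≤n
step-≤1 (suc a) (suc i) = step-≤1 a i

step-mono : ∀ a i → step a i ≤ step a (suc i)
step-mono zero    i       = ≤-refl
step-mono (suc a) zero    = z≤n
step-mono (suc a) (suc i) = step-mono a i

step-even-even : ∀ a i → step (a + a) (i + i) ≡ step a i
step-even-even zero    i       = refl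
step-even-even (suc a) zero    = refl
step-even-even (suc a) (suc i) rewrite +-suc a a | +-suc i i = step-even-even a i

step-even-odd : ∀ a i → step (a + a) (suc (i + i)) ≡ step a i
step-even-odd zero    i       = refl
step-even-odd (suc a) zero    rewrite +-suc a a = refl
step-even-odd (suc a) (suc i) rewrite +-suc a a | +-suc i i = step-even-odd a i

step-odd-even : ∀ a i → step (suc (a + a)) (i + i) ≡ step (suc a) i
step-odd-even a zero    = refl
step-odd-even a (suc i) rewrite +-suc i i = step-even-odd a i

step-odd-odd : ∀ a i → step (suc (a + a)) (suc (i + i)) ≡ step a i
step-odd-odd = step-even-even

-- Throughout, m = k + 1 is the block length of a 4-graceful labelling of C_{4m}.

-- the largest admissible label 4(m+1) - 1
top : ℕ → ℕ
top k = 3 + 4 * suc k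

-- Along the path v₀ v₁ … v_{4m-1} the edge labels descend from the top by one per
-- edge, skipping one value once m edges are passed, two values once 2m - 1 are
-- passed and one value once 3m - 1 are passed; cut k j counts the skipped values.
cut : ℕ → ℕ → ℕ
cut k j = step (suc k) j + 2 * step (suc (k + k)) j + step (suc (suc (k + k + k))) j

pathLabel : ℕ → ℕ → ℕ
pathLabel k j = top k ∸ (j + cut k j)

-- the value 2(m+1) + 1 skipped by the path; it is the label of the closing edge
closingLabel : ℕ → ℕ
closingLabel k = 5 + (k + k)

-- The path edges j with segStart k q ≤ j < segLimit k q form the segment whose
-- labels fill block q; on it the cut is constant, equal to segCut q.
segStart : ℕ → ℕ → ℕ
segStart k 0 = suc (suc (k + k + k))
segStart k 1 = suc (k + k)
segStart k 2 = suc k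
segStart k _ = 0

segLimit : ℕ → ℕ → ℕ
segLimit k 0 = 3 + 4 * k
segLimit k 1 = suc (suc (k + k + k))
segLimit k 2 = suc (k + k)
segLimit k _ = suc k

segCut : ℕ → ℕ
segCut 0 = 4
segCut 1 = 3
segCut 2 = 1
segCut _ = 0

-- a segment spans m edge positions after its start; the window of segment 2 stops
-- one position earlier, leaving room for the closing label
segEnd : ℕ → ℕ → ℕ
segEnd k q = segStart k q + suc k

record Position (k j q s : ℕ) : Set where
  field
    q<4     : q < 4
    start≤j : segStart k q ≤ j
    j<limit : j < segLimit k q
    j+s≡end : j + s ≡ segEnd k q

limit≤end : ∀ k q → segLimit k q ≤ segEnd k q
limit≤end k 0 = ≤-by 0 (lemma k)
  where
  lemma : ∀ k → 3 + 4 * k + 0 ≡ suc (suc (k + k + k)) + suc k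
  lemma = solve-∀
limit≤end k 1 = ≤-by 0 (lemma k)
  where
  lemma : ∀ k → suc (suc (k + k + k)) + 0 ≡ suc (k + k) + suc k
  lemma = solve-∀
limit≤end k 2 = ≤-by 1 (lemma k)
  where
  lemma : ∀ k → suc (k + k) + 1 ≡ suc k + suc k
  lemma = solve-∀
limit≤end k (suc (suc (suc _))) = ≤-refl

limit<4m : ∀ k q → segLimit k q < 4 * suc k
limit<4m k 0 = ≤-by 0 (lemma k)
  where
  lemma : ∀ k → suc (3 + 4 * k) + 0 ≡ 4 * suc k
  lemma = solve-∀
limit<4m k 1 = ≤-by (suc k) (lemma k)
  where
  lemma : ∀ k → suc (suc (suc (k + k + k))) + suc k ≡ 4 * suc k
  lemma = solve-∀
limit<4m k 2 = ≤-by (suc (suc (k + k))) (lemma k)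
  where
  lemma : ∀ k → suc (suc (k + k)) + suc (suc (k + k)) ≡ 4 * suc k
  lemma = solve-∀
limit<4m k (suc (suc (suc _))) = ≤-by (suc (suc (k + k + k))) (lemma k)
  where
  lemma : ∀ k → suc (suc k) + suc (suc (k + k + k)) ≡ 4 * suc k
  lemma = solve-∀

top-split : ∀ k q → q < 4 → top k ≡ segEnd k q + segCut q + q * (suc k + 1)
top-split k 0 _ = lemma k
  where
  lemma : ∀ k → 3 + 4 * suc k ≡ suc (suc (k + k + k)) + suc k + 4 + 0 * (suc k + 1)
  lemma = solve-∀
top-split k 1 _ = lemma k
  where
  lemma : ∀ k → 3 + 4 * suc k ≡ suc (k + k) + suc k + 3 + 1 * (suc k + 1)
  lemma = solve-∀
top-split k 2 _ = lemma k
  where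
  lemma : ∀ k → 3 + 4 * suc k ≡ suc k + suc k + 1 + 2 * (suc k + 1)
  lemma = solve-∀
top-split k 3 _ = lemma k
  where
  lemma : ∀ k → 3 + 4 * suc k ≡ 0 + suc k + 0 + 3 * (suc k + 1)
  lemma = solve-∀
top-split k (suc (suc (suc (suc _)))) (s≤s (s≤s (s≤s (s≤s ()))))

m≤2m-1 : ∀ k → suc k ≤ suc (k + k)
m≤2m-1 k = s≤s (m≤m+n k k)

2m-1≤3m-1 : ∀ k → suc (k + k) ≤ suc (suc (k + k + k))
2m-1≤3m-1 k = m≤n⇒m≤1+n (s≤s (m≤m+n (k + k) k))

cut≡ : ∀ {k j x y z} → step (suc k) j ≡ x → step (suc (k + k)) j ≡ y →
       step (suc (suc (k + k + k))) j ≡ z → cut k j ≡ x + 2 * y + z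
cut≡ refl refl refl = refl

segment-cut : ∀ k q {j} → segStart k q ≤ j → j < segLimit k q → cut k j ≡ segCut q
segment-cut k 0 {j} 3m-1≤j _ =
  cut≡ {k} {j} (step-on (≤-trans (≤-trans (m≤2m-1 k) (2m-1≤3m-1 k)) 3m-1≤j))
       (step-on (≤-trans (2m-1≤3m-1 k) 3m-1≤j)) (step-on 3m-1≤j)
segment-cut k 1 {j} 2m-1≤j j<3m-1 =
  cut≡ {k} {j} (step-on (≤-trans (m≤2m-1 k) 2m-1≤j)) (step-on 2m-1≤j) (step-off j<3m-1)
segment-cut k 2 {j} m≤j j<2m-1 =
  cut≡ {k} {j} (step-on m≤j) (step-off j<2m-1) (step-off (<-≤-trans j<2m-1 (2m-1≤3m-1 k)))
segment-cut k (suc (suc (suc _))) {j} _ j<m =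
  cut≡ {k} {j} (step-off j<m) (step-off (<-≤-trans j<m (m≤2m-1 k)))
       (step-off (<-≤-trans j<m (≤-trans (m≤2m-1 k) (2m-1≤3m-1 k))))

gap-positive : ∀ {j s e} → j < e → j + s ≡ e → 1 ≤ s
gap-positive {j} {zero}  j<e j+0≡e = contradiction (trans (sym (+-identityʳ j)) j+0≡e) (<⇒≢ j<e)
gap-positive {s = suc _} _   _     = s≤s z≤n

top-at-position : ∀ {k j q s} → Position k j q s → top k ≡ (j + cut k j) + (q * (suc k + 1) + s)
top-at-position {k} {j} {q} {s} pos = begin
  top k                                    ≡⟨ top-split k q q<4 ⟩
  segEnd k q + segCut q + q * (suc k + 1)  ≡⟨ cong (λ e → e + segCut q + q * (suc k + 1)) (sym j+s≡end) ⟩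
  j + s + segCut q + q * (suc k + 1)       ≡⟨ rearrange j s (segCut q) _ ⟩
  (j + segCut q) + (q * (suc k + 1) + s)   ≡⟨ cong (λ c → (j + c) + (q * (suc k + 1) + s)) (sym (segment-cut k q start≤j j<limit)) ⟩
  (j + cut k j) + (q * (suc k + 1) + s)    ∎
  where
  open Position pos
  open ≡-Reasoning
  rearrange : ∀ j s o b → j + s + o + b ≡ (j + o) + (b + s)
  rearrange = solve-∀

position-label : ∀ {k j q s} → Position k j q s → pathLabel k j ≡ q * (suc k + 1) + s
position-label {k} {j} pos = trans (cong (_∸ (j + cut k j)) (top-at-position pos)) (m+n∸m≡n (j + cut k j) _)

position-inBlock : ∀ {k j q s} → Position k j q s → InBlock (suc k) q s (pathLabel k j)
position-inBlock {k} {j} {q} {s} pos = 1≤s , s≤m , position-label pos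
  where
  open Position pos
  1≤s : 1 ≤ s
  1≤s = gap-positive (<-≤-trans j<limit (limit≤end k q)) j+s≡end
  s≤m : s ≤ suc k
  s≤m = +-cancelˡ-≤ (segStart k q) s (suc k) (subst (segStart k q + s ≤_) j+s≡end (+-monoˡ-≤ s start≤j))

window-position : ∀ k q {j} → q < 4 → segStart k q ≤ j → j < segLimit k q → ∃[ s ] Position k j q s
window-position k q {j} q<4 start≤j j<limit = segEnd k q ∸ j , record
  { q<4 = q<4 ; start≤j = start≤j ; j<limit = j<limit
  ; j+s≡end = m+[n∸m]≡n (<⇒≤ (<-≤-trans j<limit (limit≤end k q))) }

edge-position : ∀ {k j} → suc j < 4 * suc k → ∃[ q ] ∃[ s ] Position k j q s
edge-position {k} {j} j+1<4m with j <? suc k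
... | yes j<m = 3 , window-position k 3 (s<s (s<s (s<s z<s))) z≤n j<m
... | no j≮m with j <? suc (k + k)
...   | yes j<2m-1 = 2 , window-position k 2 (s<s (s<s z<s)) (≮⇒≥ j≮m) j<2m-1
...   | no j≮2m-1 with j <? suc (suc (k + k + k))
...     | yes j<3m-1 = 1 , window-position k 1 (s<s z<s) (≮⇒≥ j≮2m-1) j<3m-1
...     | no j≮3m-1 = 0 , window-position k 0 z<s (≮⇒≥ j≮3m-1) j<4m-1
  where
  4m≡ : ∀ k → 4 * suc k ≡ suc (3 + 4 * k)
  4m≡ = solve-∀
  j<4m-1 : j < 3 + 4 * k
  j<4m-1 = s≤s⁻¹ (subst (suc j <_) (4m≡ k) j+1<4m)

back-position : ∀ k q {s} → q < 4 → s ≤ suc k → segEnd k q ∸ s < segLimit k q →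
                Position k (segEnd k q ∸ s) q s
back-position k q {s} q<4 s≤m below = record
  { q<4 = q<4 ; start≤j = start≤j ; j<limit = below
  ; j+s≡end = m∸n+n≡m (≤-trans s≤m (m≤n+m (suc k) (segStart k q))) }
  where
  start≤j : segStart k q ≤ segEnd k q ∸ s
  start≤j = ≤-trans (≤-reflexive (sym (m+n∸n≡m (segStart k q) s)))
                    (∸-monoˡ-≤ s (+-monoʳ-≤ (segStart k q) s≤m))

end∸s<end : ∀ k q {s} → 1 ≤ s → s ≤ suc k → segEnd k q ∸ s < segEnd k q
end∸s<end k q 1≤s s≤m = ∸-monoʳ-< 1≤s (≤-trans s≤m (m≤n+m (suc k) (segStart k q)))

block-position : ∀ {k q s} → q < 4 → 1 ≤ s → s ≤ suc k → (q ≡ 2 × s ≡ 1) ⊎ ∃[ j ] Position k j q s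
block-position {k} {0} {s} q<4 1≤s s≤m =
  inj₂ (_ , back-position k 0 q<4 s≤m (subst (segEnd k 0 ∸ s <_) (sym (limit≡end k)) (end∸s<end k 0 1≤s s≤m)))
  where
  limit≡end : ∀ k → 3 + 4 * k ≡ suc (suc (k + k + k)) + suc k
  limit≡end = solve-∀
block-position {k} {1} {s} q<4 1≤s s≤m =
  inj₂ (_ , back-position k 1 q<4 s≤m (subst (segEnd k 1 ∸ s <_) (cong suc (+-suc (k + k) k)) (end∸s<end k 1 1≤s s≤m)))
block-position {k} {2} {1} _ _ _ = inj₁ (refl , refl)
block-position {k} {2} {suc (suc s)} q<4 _ s≤m =
  inj₂ (_ , back-position k 2 q<4 s≤m (subst (λ e → e ∸ suc s < suc (k + k)) (sym (+-suc k k)) below))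
  where
  below : suc (k + k) ∸ suc s < suc (k + k)
  below = ∸-monoʳ-< z<s (≤-trans (s≤s⁻¹ s≤m) (m≤n⇒m≤1+n (m≤m+n k k)))
block-position {k} {suc (suc (suc _))} q<4 1≤s s≤m = inj₂ (_ , back-position k _ q<4 s≤m (end∸s<end k 3 1≤s s≤m))

closing-inBlock : ∀ k → InBlock (suc k) 2 1 (closingLabel k)
closing-inBlock k = s≤s z≤n , s≤s z≤n , lemma k
  where
  lemma : ∀ k → 5 + (k + k) ≡ 2 * (suc k + 1) + 1
  lemma = solve-∀

staircase : ∀ k t → InTarget 4 (suc k) t ⇔
            (t ≡ closingLabel k ⊎ ∃[ j ] (suc j < 4 * suc k × pathLabel k j ≡ t))
staircase k t = mk⇔ to from
  where
  to : InTarget 4 (suc k) t → t ≡ closingLabel k ⊎ ∃[ j ] (suc j < 4 * suc k × pathLabel k j ≡ t)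
  to target with target⇒block target
  ... | q , s , q<4 , 1≤s , s≤m , t≡ with block-position {k} q<4 1≤s s≤m
  ...   | inj₁ (refl , refl) = inj₁ (trans t≡ (sym (proj₂ (proj₂ (closing-inBlock k)))))
  ...   | inj₂ (j , pos) =
    inj₂ (j , ≤-<-trans (Position.j<limit pos) (limit<4m k q) , trans (position-label pos) (sym t≡))
  from : t ≡ closingLabel k ⊎ ∃[ j ] (suc j < 4 * suc k × pathLabel k j ≡ t) → InTarget 4 (suc k) t
  from (inj₁ refl) = block⇒target (s<s (s<s z<s)) (closing-inBlock k)
  from (inj₂ (j , j+1<4m , refl)) with edge-position j+1<4m
  ... | q , s , pos = block⇒target (Position.q<4 pos) (position-inBlock pos)

increasing-< : ∀ (f : ℕ → ℕ) → (∀ i → f i < f (suc i)) → ∀ {i j} → i < j → f i < f j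
increasing-< f up {i} {suc j} (s≤s i≤j) with m≤n⇒m<n∨m≡n i≤j
... | inj₁ i<j  = <-trans (increasing-< f up i<j) (up j)
... | inj₂ refl = up j

increasing-injective : ∀ (f : ℕ → ℕ) → (∀ i → f i < f (suc i)) → ∀ {i j} → f i ≡ f j → i ≡ j
increasing-injective f up {i} {j} fi≡fj with <-cmp i j
... | tri< i<j _ _ = contradiction fi≡fj (<⇒≢ (increasing-< f up i<j))
... | tri≈ _ i≡j _ = i≡j
... | tri> _ _ j<i = contradiction (sym fi≡fj) (<⇒≢ (increasing-< f up j<i))

∸-split : ∀ T X Y → X + Y ≤ T → T ∸ X ≡ Y + (T ∸ (X + Y))
∸-split T X Y X+Y≤T = begin
  T ∸ X                       ≡⟨ cong (_∸ X) (sym (m+[n∸m]≡n X+Y≤T)) ⟩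
  X + Y + (T ∸ (X + Y)) ∸ X   ≡⟨ cong (_∸ X) (+-assoc X Y _) ⟩
  X + (Y + (T ∸ (X + Y))) ∸ X ≡⟨ m+n∸m≡n X _ ⟩
  Y + (T ∸ (X + Y))           ∎
  where open ≡-Reasoning

weight≤top : ∀ {k j} → suc j < 4 * suc k → j + cut k j ≤ top k
weight≤top j+1<4m with edge-position j+1<4m
... | _ , _ , pos = ≤-by _ (sym (top-at-position pos))

⌊suc[n+n]/2⌋ : ∀ n → ⌊ suc (n + n) /2⌋ ≡ n
⌊suc[n+n]/2⌋ zero = refl
⌊suc[n+n]/2⌋ (suc n) rewrite +-suc n n = cong suc (⌊suc[n+n]/2⌋ n)

half-bound : ∀ {i T} → i + i < suc (suc (T + T)) → i ≤ T
half-bound {i} {T} i+i<2T+2 with i ≤? T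
... | yes i≤T = i≤T
... | no  i≰T = contradiction i+i<2T+2 (≤⇒≯ (subst (_≤ i + i) (+-suc (suc T) T) (+-mono-≤ T<i T<i)))
  where
  T<i = ≰⇒> i≰T

-- Bookkeeping behind both edge types: the shifts of the two end labels add up to
-- the cut exactly when their indicator parts do.
weights : ∀ i i′ A P R X Z → X + Z ≡ P + R → (i + R) + (i′ + 2 * A + P) ≡ (i + i′) + (X + 2 * A + Z)
weights i i′ A P R X Z X+Z≡P+R = begin
  (i + R) + (i′ + 2 * A + P)  ≡⟨ regroup i i′ A P R ⟩
  (i + i′ + 2 * A) + (P + R)  ≡⟨ cong (i + i′ + 2 * A +_) (sym X+Z≡P+R) ⟩
  (i + i′ + 2 * A) + (X + Z)  ≡⟨ regroup′ i i′ A X Z ⟩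
  (i + i′) + (X + 2 * A + Z)  ∎
  where
  open ≡-Reasoning
  regroup : ∀ i i′ A P R → (i + R) + (i′ + 2 * A + P) ≡ (i + i′ + 2 * A) + (P + R)
  regroup = solve-∀
  regroup′ : ∀ i i′ A X Z → (i + i′ + 2 * A) + (X + Z) ≡ (i + i′) + (X + 2 * A + Z)
  regroup′ = solve-∀

-- The shifts p (for the even vertices) and r (for the odd vertices) are admissible when
-- the jumps of the vertex labels reproduce the jumps of the cut on every edge.
record Admissible (k p r : ℕ) : Set where
  field
    even-edges : ∀ i → step (suc k) (i + i) + step (suc (suc (k + k + k))) (i + i) ≡ step p i + step r i
    odd-edges  : ∀ i → step (suc k) (suc (i + i)) + step (suc (suc (k + k + k))) (suc (i + i)) ≡
                       step p (suc i) + step r i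
    1≤p        : 1 ≤ p
    p≤2m-1     : p ≤ suc (k + k)
    r≤2m-1     : r ≤ suc (k + k)

module Labelling {k p r : ℕ} (adm : Admissible k p r) where
  open Admissible adm

  low : ℕ → ℕ
  low i = i + 2 * step (suc k) i + step p i

  highShift : ℕ → ℕ
  highShift i = i + step r i

  high : ℕ → ℕ
  high i = top k ∸ highShift i

  label : ℕ → ℕ
  label v = if isOdd v then high ⌊ v /2⌋ else low ⌊ v /2⌋

  label-even : ∀ i → label (i + i) ≡ low i
  label-even i rewrite isOdd-double i = cong low (sym (n≡⌊n+n/2⌋ i))

  label-odd : ∀ i → label (suc (i + i)) ≡ high i
  label-odd i rewrite isOdd-double i = cong high (⌊suc[n+n]/2⌋ i)

  low-increasing : ∀ i → low i < low (suc i)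
  low-increasing i = s≤s (+-mono-≤ (+-monoʳ-≤ i (*-monoʳ-≤ 2 (step-mono (suc k) i))) (step-mono p i))

  highShift-increasing : ∀ i → highShift i < highShift (suc i)
  highShift-increasing i = s≤s (+-monoʳ-≤ i (step-mono r i))

  low≤ : ∀ i → low i ≤ i + 3
  low≤ i = ≤-trans (+-mono-≤ (+-monoʳ-≤ i (*-monoʳ-≤ 2 (step-≤1 (suc k) i))) (step-≤1 p i))
                   (≤-reflexive (+-assoc i 2 1))

  highShift≤ : ∀ i → highShift i ≤ i + 1
  highShift≤ i = +-monoʳ-≤ i (step-≤1 r i)

  even-weight : ∀ i → highShift i + low i ≡ (i + i) + cut k (i + i)
  even-weight i = trans (weights i i (step (suc k) i) (step p i) (step r i) X Z (even-edges i))
    (cong (λ a → i + i + (X + 2 * a + Z)) (sym (step-odd-even k i)))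
    where
    X = step (suc k) (i + i)
    Z = step (suc (suc (k + k + k))) (i + i)

  odd-weight : ∀ i → highShift i + low (suc i) ≡ suc (i + i) + cut k (suc (i + i))
  odd-weight i = trans (weights i (suc i) (step k i) (step p (suc i)) (step r i) X Z (odd-edges i))
    (cong₂ (λ n a → n + (X + 2 * a + Z)) (+-suc i i) (sym (step-odd-odd k i)))
    where
    X = step (suc k) (suc (i + i))
    Z = step (suc (suc (k + k + k))) (suc (i + i))

  high-over-low : ∀ i {i′ j} → suc j < 4 * suc k → highShift i + low i′ ≡ j + cut k j →
                  high i ≡ low i′ + pathLabel k j
  high-over-low i {i′} {j} j+1<4m weight≡ =
    trans (∸-split (top k) (highShift i) (low i′) (subst (_≤ top k) (sym weight≡) (weight≤top j+1<4m)))
          (cong (λ w → low i′ + (top k ∸ w)) weight≡)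

  inner-edge : ∀ {j} → suc j < 4 * suc k → ∣ label j - label (suc j) ∣ ≡ pathLabel k j
  inner-edge {j} j+1<4m with parityView j
  ... | even i = begin
    ∣ label (i + i) - label (suc (i + i)) ∣ ≡⟨ cong₂ ∣_-_∣ (label-even i) (label-odd i) ⟩
    ∣ low i - high i ∣                      ≡⟨ cong (∣ low i -_∣) (high-over-low i j+1<4m (even-weight i)) ⟩
    ∣ low i - low i + pathLabel k (i + i) ∣ ≡⟨ ∣m-m+n∣≡n (low i) _ ⟩
    pathLabel k (i + i)                     ∎
    where open ≡-Reasoning
  ... | odd i = begin
    ∣ label (suc (i + i)) - label (suc (suc (i + i))) ∣ ≡⟨ cong₂ ∣_-_∣ (label-odd i) label-next ⟩
    ∣ high i - low (suc i) ∣                            ≡⟨ ∣-∣-comm (high i) (low (suc i)) ⟩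
    ∣ low (suc i) - high i ∣                            ≡⟨ cong (∣ low (suc i) -_∣) (high-over-low i {suc i} j+1<4m (odd-weight i)) ⟩
    ∣ low (suc i) - low (suc i) + pathLabel k (suc (i + i)) ∣ ≡⟨ ∣m-m+n∣≡n (low (suc i)) _ ⟩
    pathLabel k (suc (i + i))                           ∎
    where
    open ≡-Reasoning
    label-next : label (suc (suc (i + i))) ≡ low (suc i)
    label-next = trans (cong (λ n → label (suc n)) (sym (+-suc i i))) (label-even (suc i))

  -- the last vertex has index 4m - 1 = 2T + 1, where T = 2m - 1 is the largest half-index
  4m≡2T+2 : 4 * suc k ≡ suc (suc (suc (k + k) + suc (k + k)))
  4m≡2T+2 = lemma k
    where
    lemma : ∀ k → 4 * suc k ≡ suc (suc (suc (k + k) + suc (k + k)))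
    lemma = solve-∀

  top≡T+1+closing : top k ≡ (suc (k + k) + 1) + closingLabel k
  top≡T+1+closing = lemma k
    where
    lemma : ∀ k → 3 + 4 * suc k ≡ (suc (k + k) + 1) + (5 + (k + k))
    lemma = solve-∀

  -- the closing edge [4m - 1, 0] joins the smallest high label to the label 0
  closing-edge : ∣ label (suc (suc (k + k) + suc (k + k))) - label 0 ∣ ≡ closingLabel k
  closing-edge = begin
    ∣ label (suc (T + T)) - label 0 ∣  ≡⟨ cong₂ ∣_-_∣ (label-odd T) (label-even 0) ⟩
    ∣ top k ∸ (T + step r T) - low 0 ∣ ≡⟨ cong₂ (λ a b → ∣ top k ∸ (T + a) - b ∣) (step-on r≤2m-1) (step-off 1≤p) ⟩
    ∣ top k ∸ (T + 1) - 0 ∣            ≡⟨ ∣-∣-identityʳ _ ⟩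
    top k ∸ (T + 1)                   ≡⟨ cong (_∸ (T + 1)) top≡T+1+closing ⟩
    (T + 1) + closingLabel k ∸ (T + 1) ≡⟨ m+n∸m≡n (T + 1) _ ⟩
    closingLabel k                    ∎
    where
    open ≡-Reasoning
    T = suc (k + k)

  half-index : ∀ {i} → i + i < 4 * suc k → i ≤ suc (k + k)
  half-index {i} i+i<4m = half-bound (subst (i + i <_) 4m≡2T+2 i+i<4m)

  low<closing : ∀ {i} → i ≤ suc (k + k) → low i < closingLabel k
  low<closing {i} i≤T = ≤-<-trans (low≤ i) (≤-<-trans (+-monoˡ-≤ 3 i≤T) (≤-by 0 (lemma k)))
    where
    lemma : ∀ k → suc (suc (k + k) + 3) + 0 ≡ 5 + (k + k)
    lemma = solve-∀

  highShift≤T+1 : ∀ {i} → i ≤ suc (k + k) → highShift i ≤ suc (k + k) + 1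
  highShift≤T+1 {i} i≤T = ≤-trans (highShift≤ i) (+-monoˡ-≤ 1 i≤T)

  closing≤high : ∀ {i} → i ≤ suc (k + k) → closingLabel k ≤ high i
  closing≤high {i} i≤T = begin
    closingLabel k                              ≡⟨ sym (m+n∸m≡n (suc (k + k) + 1) _) ⟩
    (suc (k + k) + 1) + closingLabel k ∸ (suc (k + k) + 1) ≡⟨ cong (_∸ (suc (k + k) + 1)) (sym top≡T+1+closing) ⟩
    top k ∸ (suc (k + k) + 1)                   ≤⟨ ∸-monoʳ-≤ (top k) (highShift≤T+1 i≤T) ⟩
    high i                                      ∎
    where open ≤-Reasoning

  label≤top : ∀ {v} → v < 4 * suc k → label v ≤ top k
  label≤top {v} v<4m with parityView v
  ... | even i = subst (_≤ top k) (sym (label-even i))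
                   (<⇒≤ (<-≤-trans (low<closing (half-index v<4m)) closing≤top))
    where
    closing≤top : closingLabel k ≤ top k
    closing≤top = subst (closingLabel k ≤_) (sym top≡T+1+closing) (m≤n+m (closingLabel k) (suc (k + k) + 1))
  ... | odd i = subst (_≤ top k) (sym (label-odd i)) (m∸n≤m (top k) (highShift i))

  separated : ∀ {v w} → v < 4 * suc k → w < 4 * suc k → isOdd v ≡ false → isOdd w ≡ true → label v < label w
  separated {v} {w} v<4m w<4m v-even w-odd with parityView v | parityView w
  ... | odd i  | _     rewrite isOdd-double i = contradiction v-even λ ()
  ... | _      | even j rewrite isOdd-double j = contradiction w-odd λ ()
  ... | even i | odd j = subst₂ _<_ (sym (label-even i)) (sym (label-odd j))
    (<-≤-trans (low<closing (half-index v<4m)) (closing≤high {j} (half-index (<-trans (n<1+n _) w<4m))))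

  label-injective : ∀ {v w} → v < 4 * suc k → w < 4 * suc k → label v ≡ label w → v ≡ w
  label-injective {v} {w} v<4m w<4m same with parityView v | parityView w
  ... | even i | even j = cong (λ n → n + n)
    (increasing-injective low low-increasing (trans (sym (label-even i)) (trans same (label-even j))))
  ... | odd i | odd j = cong (λ n → suc (n + n)) (increasing-injective highShift highShift-increasing
    (∸-cancelˡ-≡ (shift≤top i v<4m) (shift≤top j w<4m) (trans (sym (label-odd i)) (trans same (label-odd j)))))
    where
    shift≤top : ∀ i → suc (i + i) < 4 * suc k → highShift i ≤ top k
    shift≤top i h = subst (highShift i ≤_) (sym top≡T+1+closing)
      (≤-trans (highShift≤T+1 (half-index (<-trans (n<1+n _) h))) (m≤m+n _ (closingLabel k)))
  ... | even i | odd j = contradiction same (<⇒≢ (separated v<4m w<4m (isOdd-double i) (cong not (isOdd-double j))))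
  ... | odd i | even j = contradiction (sym same) (<⇒≢ (separated w<4m v<4m (isOdd-double j) (cong not (isOdd-double i))))

  edge-labels : ∀ {t} → t ∈ edgeLabels (Cycle (4 * suc k)) (label ∘ toℕ) ⇔ InTarget 4 (suc k) t
  edge-labels {t} = mk⇔ to from
    where
    last≡ : ∀ {j} → suc j ≡ 4 * suc k → j ≡ suc (suc (k + k) + suc (k + k))
    last≡ last = suc-injective (trans last 4m≡2T+2)
    to : t ∈ edgeLabels (Cycle (4 * suc k)) (label ∘ toℕ) → InTarget 4 (suc k) t
    to t∈ with Equivalence.to (cycle-labels label) t∈
    ... | inj₁ (j , j+1<4m , refl) =
      Equivalence.from (staircase k t) (inj₂ (j , j+1<4m , sym (inner-edge j+1<4m)))
    ... | inj₂ (j , last , refl) =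
      Equivalence.from (staircase k t) (inj₁ (trans (cong (λ v → ∣ label v - label 0 ∣) (last≡ last)) closing-edge))
    from : InTarget 4 (suc k) t → t ∈ edgeLabels (Cycle (4 * suc k)) (label ∘ toℕ)
    from target with Equivalence.to (staircase k t) target
    ... | inj₁ refl = Equivalence.from (cycle-labels label) (inj₂ (_ , sym 4m≡2T+2 , sym closing-edge))
    ... | inj₂ (j , j+1<4m , refl) = Equivalence.from (cycle-labels label) (inj₁ (j , j+1<4m , sym (inner-edge j+1<4m)))

  graceful-α : HasDGracefulα (Cycle (4 * suc k)) 4
  graceful-α = suc k , label ∘ toℕ , record
    { graceful = record
      { sizeEq    = size-Cycle
      ; injective = λ same → toℕ-injective (label-injective (toℕ<n _) (toℕ<n _) same)
      ; bounded   = λ v → subst (label (toℕ v) <_) (4[m+1]≡ k) (s≤s (label≤top (toℕ<n v)))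
      ; labels    = λ t → edge-labels
      }
    ; part      = isOdd ∘ toℕ
    ; bipartite = parity-bipartition (trans (cong isOdd (4m≡2m+2m k)) (isOdd-double (suc k + suc k)))
    ; separated = λ x y → separated (toℕ<n x) (toℕ<n y)
    }
    where
    4[m+1]≡ : ∀ k → suc (3 + 4 * suc k) ≡ 4 * (suc k + 1)
    4[m+1]≡ = solve-∀
    4m≡2m+2m : ∀ k → 4 * suc k ≡ (suc k + suc k) + (suc k + suc k)
    4m≡2m+2m = solve-∀

admissible-m-odd : ∀ h → Admissible (h + h) (suc h) (suc (h + h + h))
admissible-m-odd h = record
  { even-edges = λ i → cong₂ _+_ (step-odd-even h i) (trans (cong (λ a → step a (i + i)) 3m-1≡2r) (step-even-even r i))
  ; odd-edges  = λ i → cong₂ _+_ (step-odd-odd h i) (trans (cong (λ a → step a (suc (i + i))) 3m-1≡2r) (step-even-odd r i))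
  ; 1≤p        = s≤s z≤n
  ; p≤2m-1     = ≤-by (h + h + h) (p-gap h)
  ; r≤2m-1     = ≤-by h (r-gap h)
  }
  where
  r = suc (h + h + h)
  3m-1≡2r : suc (suc ((h + h) + (h + h) + (h + h))) ≡ r + r
  3m-1≡2r = lemma h
    where
    lemma : ∀ h → suc (suc ((h + h) + (h + h) + (h + h))) ≡ suc (h + h + h) + suc (h + h + h)
    lemma = solve-∀
  p-gap : ∀ h → suc h + (h + h + h) ≡ suc ((h + h) + (h + h))
  p-gap = solve-∀
  r-gap : ∀ h → suc (h + h + h) + h ≡ suc ((h + h) + (h + h))
  r-gap = solve-∀

admissible-m-even : ∀ h → Admissible (suc (h + h)) (suc (suc (suc (h + h + h)))) (suc h)
admissible-m-even h = record
  { even-edges = λ i → trans (cong₂ _+_ (trans (cong (λ a → step a (i + i)) m≡2[h+1]) (step-even-even (suc h) i))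
                                        (trans (cong (λ a → step a (i + i)) 3m-1≡2w+1) (step-odd-even w i)))
                             (+-comm (step (suc h) i) _)
  ; odd-edges  = λ i → trans (cong₂ _+_ (trans (cong (λ a → step a (suc (i + i))) m≡2[h+1]) (step-even-odd (suc h) i))
                                        (trans (cong (λ a → step a (suc (i + i))) 3m-1≡2w+1) (step-odd-odd w i)))
                             (+-comm (step (suc h) i) _)
  ; 1≤p        = s≤s z≤n
  ; p≤2m-1     = ≤-by h (p-gap h)
  ; r≤2m-1     = ≤-by (h + h + h + 2) (r-gap h)
  }
  where
  w = suc (suc (h + h + h))
  m≡2[h+1] : suc (suc (h + h)) ≡ suc h + suc h
  m≡2[h+1] = cong suc (sym (+-suc h h))
  3m-1≡2w+1 : suc (suc (suc (h + h) + suc (h + h) + suc (h + h))) ≡ suc (w + w)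
  3m-1≡2w+1 = lemma h
    where
    lemma : ∀ h → suc (suc (suc (h + h) + suc (h + h) + suc (h + h))) ≡
                  suc (suc (suc (h + h + h)) + suc (suc (h + h + h)))
    lemma = solve-∀
  p-gap : ∀ h → suc (suc (suc (h + h + h))) + h ≡ suc (suc (h + h) + suc (h + h))
  p-gap = solve-∀
  r-gap : ∀ h → suc h + (h + h + h + 2) ≡ suc (suc (h + h) + suc (h + h))
  r-gap = solve-∀

theorem4p2 : (k : ℕ) → HasDGracefulα (Cycle (4 * suc k)) 4
theorem4p2 k with parityView k
... | even h = Labelling.graceful-α (admissible-m-odd h)
... | odd h  = Labelling.graceful-α (admissible-m-even h)
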